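{- Let $\mathcal M=\mathrm{CM}(H,X,p)$ be a regular Cayley map whose automorphism group is isomorphic to a group $G$. Then there exists an admissible quadruple $(G,K,x,y)$ such that $K\cong H$ and $\mathcal M$ is equivalent to the induced Cayley map $\mathrm{CM}(G,K,x,y)$.
   Context: All groups are finite. For a group $K$, a generating subset $X\subseteq K$ with $X=X^{ -1}$, $1_K\notin X$, and a cyclic permutation $p$ of $X$, $\mathrm{CM}(K,X,p)$ is the map with underlying Cayley graph $\mathrm{Cay}(K,X)$ (vertices $K$, edges $\{k,kx\}$) and rotation $(k,kx)\mapsto(k,k\,p(x))$; a map automorphism is a permutation of darts commuting with the rotation and the dart-reversing involution; the map is regular if its automorphism group is transitive on darts. Cayley maps $\mathrm{CM}(K_i,X_i,p_i)$, $i=1,2$, are equivalent if some group isomorphism $\phi:K_1\to K_2$ satisfies $\phi(X_1)=X_2$ and $\phi p_1=p_2\phi$. For a group $G$, a non-trivial subgroup $K\le G$ and $x,y\in G$ with $y\ne1_G$, $(G,K,x,y)$ is admissible if, with $Y=\langle y\rangle$: $G=KY$ and $|K\cap Y|=1$; $Y$ is core-free in $G$; $G=\langle Y,x\rangle$ and $YxY=Yx^{ -1}Y$. Then $G$ acts on $K$ by letting $g(k)$ be the unique element of $K$ with $g(k)Y=gkY$; with $X'=\{k\in K: kY\subseteq YxY\}$, $x_0\in K$ the element with $x_0Y=xY$, and $p'=(x_0,y(x_0),\dots,y^{|Y|-1}(x_0))$ (a cyclic permutation of $X'$), the induced Cayley map is $\mathrm{CM}(G,K,x,y):=\mathrm{CM}(K,X',p')$.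 -}

module Defs where

open import Data.Nat using (ℕ; zero; suc)
open import Data.Fin using (Fin)
open import Data.Bool using (Bool; T)
open import Data.Sum using (_⊎_)
open import Data.Product using (Σ; ∃; ∃-syntax; _×_; _,_)
open import Relation.Binary.PropositionalEquality using (_≡_)
open import Relation.Nullary using (¬_)
open import Function.Bundles using (_↔_)
open import Algebra.Structures using (IsGroup)

record FinGroup : Set₁ where
  infixl 7 _∙_
  field
    Carrier : Set
    _∙_     : Carrier → Carrier → Carrier
    ε       : Carrier
    _⁻¹     : Carrier → Carrier
    isGroup : IsGroup _≡_ _∙_ ε _⁻¹
    finite  : ∃[ n ] (Carrier ↔ Fin n)

  pow : Carrier → ℕ → Carrier
  pow g zero    = ε
  pow g (suc n) = g ∙ pow g n

module _ (G : FinGroup) where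
  open FinGroup G

  data Gen (S : Carrier → Set) : Carrier → Set where
    gen-ε   : Gen S ε
    gen-in  : ∀ {a} → S a → Gen S a
    gen-mul : ∀ {a b} → Gen S a → Gen S b → Gen S (a ∙ b)
    gen-inv : ∀ {a} → Gen S a → Gen S (a ⁻¹)

  Generates : (Carrier → Set) → Set
  Generates S = ∀ g → Gen S g

  record IsSubgroup (K : Carrier → Bool) : Set where
    field
      K-ε   : T (K ε)
      K-mul : ∀ {a b} → T (K a) → T (K b) → T (K (a ∙ b))
      K-inv : ∀ {a} → T (K a) → T (K (a ⁻¹))

iter : {A : Set} → (A → A) → ℕ → A → A
iter f zero    a = a
iter f (suc n) a = f (iter f n a)

module _ (H : FinGroup) where
  open FinGroup H

  -- X ⊆ H a generating subset with X = X⁻¹ and 1 ∉ X, and p a cyclic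
  -- permutation of X (p is a function on H whose restriction to X matters)
  record IsCayleyMapData (X : Carrier → Bool) (p : Carrier → Carrier) : Set where
    field
      X-inv  : ∀ {x} → T (X x) → T (X (x ⁻¹))
      X-1    : ¬ T (X ε)
      X-gen  : Generates H (λ x → T (X x))
      p-X    : ∀ {x} → T (X x) → T (X (p x))
      p-cyc  : ∀ {x x'} → T (X x) → T (X x') → ∃[ i ] (iter p i x ≡ x')

  module _ {X : Carrier → Bool} {p : Carrier → Carrier}
           (cm : IsCayleyMapData X p) where
    open IsCayleyMapData cm

    -- dart (k, k x) of Cay(H, X), coded as the pair (k , x) with x ∈ X
    Dart : Set
    Dart = Σ Carrier λ k → Σ Carrier λ x → T (X x)

    rot : Dart → Dart
    rot (k , x , m) = k , p x , p-X m

    rev : Dart → Dart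
    rev (k , x , m) = k ∙ x , x ⁻¹ , X-inv m

    record IsMapAut (f : Dart → Dart) : Set where
      field
        f-inj : ∀ {d d'} → f d ≡ f d' → d ≡ d'
        f-sur : ∀ d → ∃[ d' ] (f d' ≡ d)
        f-rot : ∀ d → f (rot d) ≡ rot (f d)
        f-rev : ∀ d → f (rev d) ≡ rev (f d)

    IsRegular : Set
    IsRegular = ∀ d d' → ∃[ f ] (IsMapAut f × f d ≡ d')

    record AutIso (G : FinGroup) : Set where
      open FinGroup G renaming (Carrier to GC; _∙_ to _·_)
      field
        ρ     : GC → Dart → Dart
        ρ-aut : ∀ g → IsMapAut (ρ g)
        ρ-hom : ∀ g h d → ρ (g · h) d ≡ ρ g (ρ h d)
        ρ-inj : ∀ g h → (∀ d → ρ g d ≡ ρ h d) → g ≡ h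
        ρ-sur : ∀ f → IsMapAut f → ∃[ g ] (∀ d → ρ g d ≡ f d)

module _ (G : FinGroup) where
  open FinGroup G

  module _ (K : Carrier → Bool) (x y : Carrier) where

    InY : Carrier → Set
    InY g = ∃[ i ] (g ≡ pow y i)

    -- equality of left cosets a Y = b Y (as sets)
    SameCoset : Carrier → Carrier → Set
    SameCoset a b = (∀ i → ∃[ j ] (a ∙ pow y i ≡ b ∙ pow y j))
                  × (∀ i → ∃[ j ] (b ∙ pow y i ≡ a ∙ pow y j))

    record Admissible : Set where
      field
        K-sub     : IsSubgroup G K
        K-nontriv : ∃[ k ] (T (K k) × ¬ (k ≡ ε))
        y≢1       : ¬ (y ≡ ε)
        G=KY      : ∀ g → ∃[ k ] ∃[ i ] (T (K k) × g ≡ k ∙ pow y i)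
        K∩Y=1     : ∀ g → T (K g) → InY g → g ≡ ε
        -- Y is core-free: ⋂_g g Y g⁻¹ = 1
        Y-corefree : ∀ h → (∀ g → ∃[ i ] (h ≡ (g ∙ pow y i) ∙ (g ⁻¹))) → h ≡ ε
        G=⟨Y,x⟩   : Generates G (λ g → (g ≡ y) ⊎ (g ≡ x))
        YxY⊆Yx⁻¹Y : ∀ i j → ∃[ i' ] ∃[ j' ]
                      ((pow y i ∙ x) ∙ pow y j ≡ (pow y i' ∙ (x ⁻¹)) ∙ pow y j')
        Yx⁻¹Y⊆YxY : ∀ i j → ∃[ i' ] ∃[ j' ]
                      ((pow y i ∙ (x ⁻¹)) ∙ pow y j ≡ (pow y i' ∙ x) ∙ pow y j')

    -- the action of G on K: (g(k) = k') ⇔ k' ∈ K and k' Y = g k Y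
    ActsTo : Carrier → Carrier → Carrier → Set
    ActsTo g k k' = T (K k') × SameCoset k' (g ∙ k)

    InducedX : Carrier → Set
    InducedX k = T (K k) × (∀ i → ∃[ a ] ∃[ b ] (k ∙ pow y i ≡ (pow y a ∙ x) ∙ pow y b))

    IsX₀ : Carrier → Set
    IsX₀ x₀ = T (K x₀) × SameCoset x₀ x

    -- graph of the cycle p' = (x₀, y(x₀), …, y^{|Y|-1}(x₀)):
    -- p'(y^j(x₀)) = y^{j+1}(x₀)
    InducedRot : Carrier → Carrier → Set
    InducedRot k k' = ∀ x₀ j → IsX₀ x₀ → ActsTo (pow y j) x₀ k →
                      ActsTo (pow y (suc j)) x₀ k'

record InducedEquiv (H G : FinGroup) (X : FinGroup.Carrier H → Bool)
                    (p : FinGroup.Carrier H → FinGroup.Carrier H)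
                    (K : FinGroup.Carrier G → Bool)
                    (x y : FinGroup.Carrier G) : Set where
  open FinGroup H renaming (Carrier to HC; _∙_ to _*_)
  open FinGroup G renaming (Carrier to GC)
  field
    φ       : HC → GC
    φ-hom   : ∀ a b → φ (a * b) ≡ φ a ∙ φ b
    φ-inj   : ∀ {a b} → φ a ≡ φ b → a ≡ b
    φ-onto  : ∀ g → T (K g) → ∃[ h ] (φ h ≡ g)
    φ-in-K  : ∀ h → T (K (φ h))
    φ-X→X'  : ∀ h → T (X h) → InducedX G K x y (φ h)
    φ-X'→X  : ∀ h → InducedX G K x y (φ h) → T (X h)
    φ-rot   : ∀ h → T (X h) → InducedRot G K x y (φ h) (φ (p h))

module Submission where

open import Defs
open import Data.Bool using (Bool; T)
open import Data.Bool.Properties using (T-irrelevant)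
open import Data.Fin.Properties using (inj⇒≟)
open import Data.Nat using (ℕ; zero; suc)
open import Data.Product using (∃; ∃-syntax; _×_; _,_; proj₁; proj₂)
open import Data.Sum using (_⊎_; inj₁; inj₂)
open import Function.Properties.Inverse using (↔⇒↣)
open import Relation.Binary.PropositionalEquality
  using (_≡_; refl; sym; trans; cong; cong₂; subst; module ≡-Reasoning)
open import Relation.Binary.Definitions using (DecidableEquality)
open import Relation.Nullary using (¬_)
open import Relation.Nullary.Decidable using (⌊_⌋; toWitness; fromWitness)
open import Algebra.Bundles using (Group)
import Algebra.Properties.Group as GroupProperties

-- Fix the dart d₀ from 1 to x₀ ∈ X. An automorphism of a connected map is determined by the
-- image of one dart, so g ↦ g(d₀) is a bijection from G onto the darts when the map is
-- regular. Left translations of H are map automorphisms; they form the subgroup K ≅ H.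
-- Let y and x send d₀ to its rotation and to its reverse. The darts at vertex 1 form the
-- rotation orbit of d₀, so the cosets gY correspond to the vertices: hence G = KY,
-- K ∩ Y = 1, and ⋂ gYg⁻¹ fixes every vertex, so it is trivial. Reversal is an involution,
-- so x = x⁻¹, and since the map is connected, G = ⟨y, x⟩. Under h ↦ (left translation by h)
-- the vertex of y^a x is p^a(x₀), so X is carried to X′ and p to the action of y.

iter-commute : {A : Set} (f : A → A) → ∀ n a → iter f n (f a) ≡ f (iter f n a)
iter-commute f zero    a = refl
iter-commute f (suc n) a = cong f (iter-commute f n a)

iter-fixed : {A : Set} (f : A → A) {a : A} → f a ≡ a → ∀ n → iter f n a ≡ a
iter-fixed f fa≡a zero    = refl
iter-fixed f fa≡a (suc n) = trans (cong f (iter-fixed f fa≡a n)) fa≡a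

toGroup : FinGroup → Group _ _
toGroup G = record { isGroup = FinGroup.isGroup G }

module CayleyMapProperties (H : FinGroup) {X : FinGroup.Carrier H → Bool}
                           {p : FinGroup.Carrier H → FinGroup.Carrier H}
                           (cm : IsCayleyMapData H X p) where

  open FinGroup H
  open IsCayleyMapData cm
  open Group (toGroup H) using (assoc; identityʳ)
  open GroupProperties (toGroup H)
    using (∙-cancelˡ; ε⁻¹≈ε; ⁻¹-involutive; ⁻¹-anti-homo-∙; \\-leftDividesˡ; \\-leftDividesʳ; //-rightDividesʳ)

  Darts : Set
  Darts = Dart H cm

  origin : Darts → Carrier
  origin = proj₁

  label : Darts → Carrier
  label d = proj₁ (proj₂ d)

  rot^ : ℕ → Darts → Darts
  rot^ = iter (rot H cm)

  dart-≡ : ∀ {k k′ z z′} {m : T (X z)} {m′ : T (X z′)} →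
           k ≡ k′ → z ≡ z′ → _≡_ {A = Darts} (k , z , m) (k′ , z′ , m′)
  dart-≡ {z = z} refl refl = cong (λ m → _ , z , m) (T-irrelevant _ _)

  dart-≡-by-ends : ∀ {d d′} → origin d ≡ origin d′ →
                   origin (rev H cm d) ≡ origin (rev H cm d′) → d ≡ d′
  dart-≡-by-ends {k , z , _} {_ , z′ , _} refl kz≡kz′ = dart-≡ refl (∙-cancelˡ k z z′ kz≡kz′)

  rev-involutive : ∀ d → rev H cm (rev H cm d) ≡ d
  rev-involutive (k , z , _) = dart-≡ (//-rightDividesʳ z k) (⁻¹-involutive z)

  origin-rot^ : ∀ i d → origin (rot^ i d) ≡ origin d
  origin-rot^ zero    d = refl
  origin-rot^ (suc i) d = origin-rot^ i d

  label-rot^ : ∀ i d → label (rot^ i d) ≡ iter p i (label d)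
  label-rot^ zero    d = refl
  label-rot^ (suc i) d = cong p (label-rot^ i d)

  X-iter-p : ∀ i {z} → T (X z) → T (X (iter p i z))
  X-iter-p zero    z∈X = z∈X
  X-iter-p (suc i) z∈X = p-X (X-iter-p i z∈X)

  rot^-transitive : ∀ d d′ → origin d ≡ origin d′ → ∃[ i ] (rot^ i d ≡ d′)
  rot^-transitive d@(_ , _ , z∈X) (_ , _ , z′∈X) k≡k′ with p-cyc z∈X z′∈X
  ... | i , pⁱz≡z′ = i , dart-≡ (trans (origin-rot^ i d) k≡k′) (trans (label-rot^ i d) pⁱz≡z′)

  module _ {f : Darts → Darts} (f-aut : IsMapAut H cm f) where
    open IsMapAut f-aut

    aut-rot^ : ∀ i d → f (rot^ i d) ≡ rot^ i (f d)
    aut-rot^ zero    d = refl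
    aut-rot^ (suc i) d = trans (f-rot _) (cong (rot H cm) (aut-rot^ i d))

    aut-respects-origin : ∀ {d d′} → origin d ≡ origin d′ → origin (f d) ≡ origin (f d′)
    aut-respects-origin {d} {d′} k≡k′ with rot^-transitive d d′ k≡k′
    ... | i , refl = sym (trans (cong origin (aut-rot^ i d)) (origin-rot^ i (f d)))

  -- Connectedness of Cay(H, X): the darts at a vertex are one rot-orbit, and rev moves
  -- from vertex k to k ∙ a for every generator a.
  module _ (P : Darts → Set) (P-rot : ∀ {d} → P d → P (rot H cm d))
           (P-rev : ∀ {d} → P d → P (rev H cm d)) where

    private
      AtVertex : Carrier → Set
      AtVertex k = ∀ z (z∈X : T (X z)) → P (k , z , z∈X)

      P-rot^ : ∀ i {d} → P d → P (rot^ i d)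
      P-rot^ zero    Pd = Pd
      P-rot^ (suc i) Pd = P-rot (P-rot^ i Pd)

      spread : ∀ {d} → P d → AtVertex (origin d)
      spread {d} Pd z z∈X with rot^-transitive d (origin d , z , z∈X) refl
      ... | i , eq = subst P eq (P-rot^ i Pd)

      step : ∀ {k a} → AtVertex k → T (X a) → AtVertex (k ∙ a)
      step Pk a∈X = spread (P-rev (Pk _ a∈X))

      along : ∀ {g} → Gen H (λ z → T (X z)) g →
              ∀ {k} → AtVertex k → AtVertex (k ∙ g) × AtVertex (k ∙ g ⁻¹)
      along gen-ε {k} Pk =
        subst AtVertex (sym (identityʳ k)) Pk ,
        subst AtVertex (trans (sym (identityʳ k)) (cong (k ∙_) (sym ε⁻¹≈ε))) Pk
      along (gen-in a∈X) Pk = step Pk a∈X , step Pk (X-inv a∈X)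
      along (gen-mul {a} {b} ga gb) {k} Pk =
        subst AtVertex (assoc k a b) (proj₁ (along gb (proj₁ (along ga Pk)))) ,
        subst AtVertex (trans (assoc k (b ⁻¹) (a ⁻¹)) (cong (k ∙_) (sym (⁻¹-anti-homo-∙ a b))))
              (proj₂ (along ga (proj₂ (along gb Pk))))
      along (gen-inv {a} ga) {k} Pk =
        proj₂ (along ga Pk) ,
        subst AtVertex (cong (k ∙_) (sym (⁻¹-involutive a))) (proj₁ (along ga Pk))

    dart-induction : ∀ {d₀} → P d₀ → ∀ d → P d
    dart-induction {d₀} Pd₀ (k , z , z∈X) =
      subst AtVertex (\\-leftDividesˡ (origin d₀) k) (proj₁ (along (X-gen _) (spread Pd₀))) z z∈X

  aut-unique : ∀ {f g d₀} → IsMapAut H cm f → IsMapAut H cm g → f d₀ ≡ g d₀ → ∀ d → f d ≡ g d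
  aut-unique {f} {g} f-aut g-aut = dart-induction (λ d → f d ≡ g d)
    (λ {d} fd≡gd → trans (f-rot d) (trans (cong (rot H cm) fd≡gd) (sym (g-rot d))))
    (λ {d} fd≡gd → trans (f-rev d) (trans (cong (rev H cm) fd≡gd) (sym (g-rev d))))
    where
    open IsMapAut f-aut using (f-rot; f-rev)
    open IsMapAut g-aut using () renaming (f-rot to g-rot; f-rev to g-rev)

  translate : Carrier → Darts → Darts
  translate h (k , z , z∈X) = h ∙ k , z , z∈X

  translate-∙ : ∀ a b d → translate (a ∙ b) d ≡ translate a (translate b d)
  translate-∙ a b (k , _ , _) = dart-≡ (assoc a b k) refl

  translate-aut : ∀ h → IsMapAut H cm (translate h)
  translate-aut h = record
    { f-inj = λ {d} {d′} eq →
        trans (sym (translate-inverseˡ d)) (trans (cong (translate (h ⁻¹)) eq) (translate-inverseˡ d′))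
    ; f-sur = λ d → translate (h ⁻¹) d , dart-≡ (\\-leftDividesˡ h (origin d)) refl
    ; f-rot = λ _ → refl
    ; f-rev = λ (k , z , _) → dart-≡ (sym (assoc h k z)) refl
    }
    where
    translate-inverseˡ : ∀ d → translate (h ⁻¹) (translate h d) ≡ d
    translate-inverseˡ (k , _ , _) = dart-≡ (\\-leftDividesʳ h k) refl

module AutGroupAction (H : FinGroup) {X : FinGroup.Carrier H → Bool}
                      {p : FinGroup.Carrier H → FinGroup.Carrier H}
                      (cm : IsCayleyMapData H X p) (G : FinGroup) (iso : AutIso H cm G)
                      {x₀ : FinGroup.Carrier H} (x₀∈X : T (X x₀)) where

  open FinGroup H using () renaming (Carrier to HC; _∙_ to _*_; ε to e; finite to H-finite)
  open FinGroup G
  open IsCayleyMapData cm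
  open AutIso iso
  open CayleyMapProperties H cm
  open Group (toGroup H) using () renaming (identityˡ to *-identityˡ; identityʳ to *-identityʳ)
  open Group (toGroup G) using (identityˡ; identityʳ; inverseʳ)
  open GroupProperties (toGroup H) using () renaming (identityʳ-unique to *-identityʳ-unique)
  open GroupProperties (toGroup G) using (inverseʳ-unique)
  open ≡-Reasoning

  d₀ : Darts
  d₀ = e , x₀ , x₀∈X

  orbit : Carrier → Darts
  orbit g = ρ g d₀

  orbit-∙ : ∀ g h → orbit (g ∙ h) ≡ ρ g (orbit h)
  orbit-∙ g h = ρ-hom g h d₀

  orbit-injective : ∀ {g h} → orbit g ≡ orbit h → g ≡ h
  orbit-injective {g} {h} eq = ρ-inj g h (aut-unique (ρ-aut g) (ρ-aut h) eq)

  orbit-surjective : IsRegular H cm → ∀ d → ∃[ g ] (orbit g ≡ d)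
  orbit-surjective regular d with regular d₀ d
  ... | f , f-aut , fd₀≡d with ρ-sur f f-aut
  ...   | g , ρg≗f = g , trans (ρg≗f d₀) fd₀≡d

  ρ-ε : ∀ d → ρ ε d ≡ d
  ρ-ε d = IsMapAut.f-inj (ρ-aut ε) (trans (sym (ρ-hom ε ε d)) (cong (λ g → ρ g d) (identityˡ ε)))

  orbit-ε : orbit ε ≡ d₀
  orbit-ε = ρ-ε d₀

  vertex : Carrier → HC
  vertex g = origin (orbit g)

  vertex-faithful : ∀ {g} → (∀ d → origin (ρ g d) ≡ origin d) → g ≡ ε
  vertex-faithful {g} fixes = orbit-injective (trans ρgd₀≡d₀ (sym orbit-ε))
    where
    ρgd₀≡d₀ : ρ g d₀ ≡ d₀
    ρgd₀≡d₀ = dart-≡-by-ends (fixes d₀)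
      (trans (cong origin (sym (IsMapAut.f-rev (ρ-aut g) d₀))) (fixes (rev H cm d₀)))

  translation : HC → Carrier
  translation h = proj₁ (ρ-sur (translate h) (translate-aut h))

  ρ-translation : ∀ h d → ρ (translation h) d ≡ translate h d
  ρ-translation h = proj₂ (ρ-sur (translate h) (translate-aut h))

  translation-hom : ∀ a b → translation (a * b) ≡ translation a ∙ translation b
  translation-hom a b = ρ-inj _ _ λ d → begin
    ρ (translation (a * b)) d                   ≡⟨ ρ-translation (a * b) d ⟩
    translate (a * b) d                         ≡⟨ translate-∙ a b d ⟩
    translate a (translate b d)                 ≡⟨ cong (translate a) (ρ-translation b d) ⟨
    translate a (ρ (translation b) d)           ≡⟨ ρ-translation a _ ⟨
    ρ (translation a) (ρ (translation b) d)     ≡⟨ ρ-hom (translation a) (translation b) d ⟨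
    ρ (translation a ∙ translation b) d         ∎

  vertex-translation : ∀ h → vertex (translation h) ≡ h
  vertex-translation h = trans (cong origin (ρ-translation h d₀)) (*-identityʳ h)

  translation-injective : ∀ {a b} → translation a ≡ translation b → a ≡ b
  translation-injective {a} {b} eq =
    trans (sym (vertex-translation a)) (trans (cong vertex eq) (vertex-translation b))

  origin-ρ-translation⁻¹ : ∀ h d → origin d ≡ h → origin (ρ (translation h ⁻¹) d) ≡ e
  origin-ρ-translation⁻¹ h d o≡h = *-identityʳ-unique h _ (begin
    h * origin (ρ (translation h ⁻¹) d)                      ≡⟨ cong origin (ρ-translation h _) ⟨
    origin (ρ (translation h) (ρ (translation h ⁻¹) d))      ≡⟨ cong origin (ρ-hom _ _ d) ⟨
    origin (ρ (translation h ∙ translation h ⁻¹) d)          ≡⟨ cong (λ g → origin (ρ g d)) (inverseʳ _) ⟩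
    origin (ρ ε d)                                           ≡⟨ cong origin (ρ-ε d) ⟩
    origin d                                                 ≡⟨ o≡h ⟩
    h                                                        ∎)

  private
    _≟_ : DecidableEquality HC
    _≟_ = inj⇒≟ (↔⇒↣ (proj₂ H-finite))

  -- K consists of the elements acting on darts as left translations of H (see ∈K⇒ρ-translate).
  K : Carrier → Bool
  K g = ⌊ label (orbit g) ≟ x₀ ⌋

  ∈K⇒ρ-translate : ∀ {g} → T (K g) → ∀ d → ρ g d ≡ translate (vertex g) d
  ∈K⇒ρ-translate {g} g∈K = aut-unique (ρ-aut g) (translate-aut (vertex g))
    (dart-≡ (sym (*-identityʳ (vertex g))) (toWitness g∈K))

  translation∈K : ∀ h → T (K (translation h))
  translation∈K h = fromWitness (cong label (ρ-translation h d₀))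

  K⊆translations : ∀ {g} → T (K g) → translation (vertex g) ≡ g
  K⊆translations {g} g∈K =
    ρ-inj _ _ λ d → trans (ρ-translation (vertex g) d) (sym (∈K⇒ρ-translate g∈K d))

  K-subgroup : IsSubgroup G K
  K-subgroup = record
    { K-ε   = fromWitness (cong label orbit-ε)
    ; K-mul = λ {a} {b} a∈K b∈K → fromWitness (begin
        label (orbit (a ∙ b))                   ≡⟨ cong label (orbit-∙ a b) ⟩
        label (ρ a (orbit b))                   ≡⟨ cong label (∈K⇒ρ-translate a∈K (orbit b)) ⟩
        label (orbit b)                         ≡⟨ toWitness b∈K ⟩
        x₀                                      ∎)
    ; K-inv = λ {a} a∈K → fromWitness (begin
        label (orbit (a ⁻¹))                    ≡⟨ cong label (∈K⇒ρ-translate a∈K (orbit (a ⁻¹))) ⟨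
        label (ρ a (orbit (a ⁻¹)))              ≡⟨ cong label (orbit-∙ a (a ⁻¹)) ⟨
        label (orbit (a ∙ a ⁻¹))                ≡⟨ cong (λ g → label (orbit g)) (inverseʳ a) ⟩
        label (orbit ε)                         ≡⟨ cong label orbit-ε ⟩
        x₀                                      ∎)
    }

  translation-nontrivial : ¬ translation x₀ ≡ ε
  translation-nontrivial eq = X-1 (subst (λ z → T (X z)) x₀≡e x₀∈X)
    where
    x₀≡e : x₀ ≡ e
    x₀≡e = trans (sym (vertex-translation x₀)) (trans (cong vertex eq) (cong origin orbit-ε))

  module InducedQuadruple (y x : Carrier) (orbit-y : orbit y ≡ rot H cm d₀)
                          (orbit-x : orbit x ≡ rev H cm d₀) where

    orbit-pow : ∀ i → orbit (pow y i) ≡ rot^ i d₀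
    orbit-pow zero    = orbit-ε
    orbit-pow (suc i) = begin
      orbit (y ∙ pow y i)        ≡⟨ orbit-∙ y (pow y i) ⟩
      ρ y (orbit (pow y i))      ≡⟨ cong (ρ y) (orbit-pow i) ⟩
      ρ y (rot^ i d₀)            ≡⟨ aut-rot^ (ρ-aut y) i d₀ ⟩
      rot^ i (orbit y)           ≡⟨ cong (rot^ i) orbit-y ⟩
      rot^ i (rot H cm d₀)       ≡⟨ iter-commute (rot H cm) i d₀ ⟩
      rot^ (suc i) d₀            ∎

    orbit-∙-pow : ∀ g i → orbit (g ∙ pow y i) ≡ rot^ i (orbit g)
    orbit-∙-pow g i = begin
      orbit (g ∙ pow y i)        ≡⟨ orbit-∙ g (pow y i) ⟩
      ρ g (orbit (pow y i))      ≡⟨ cong (ρ g) (orbit-pow i) ⟩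
      ρ g (rot^ i d₀)            ≡⟨ aut-rot^ (ρ-aut g) i d₀ ⟩
      rot^ i (orbit g)           ∎

    vertex-∙-pow : ∀ g i → vertex (g ∙ pow y i) ≡ vertex g
    vertex-∙-pow g i = trans (cong origin (orbit-∙-pow g i)) (origin-rot^ i (orbit g))

    vertex-pow : ∀ i → vertex (pow y i) ≡ e
    vertex-pow i = trans (cong origin (orbit-pow i)) (origin-rot^ i d₀)

    vertex-∙-congˡ : ∀ g {a b} → vertex a ≡ vertex b → vertex (g ∙ a) ≡ vertex (g ∙ b)
    vertex-∙-congˡ g {a} {b} eq = trans (cong origin (orbit-∙ g a))
      (trans (aut-respects-origin (ρ-aut g) eq) (sym (cong origin (orbit-∙ g b))))

    -- The cosets gY are the vertices of the map.
    coset-half : ∀ {a b} → vertex a ≡ vertex b → ∀ i → ∃[ j ] (a ∙ pow y i ≡ b ∙ pow y j)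
    coset-half {a} {b} eq i
      with rot^-transitive (orbit b) (rot^ i (orbit a)) (trans (sym eq) (sym (origin-rot^ i (orbit a))))
    ... | j , eqʲ = j , orbit-injective (trans (orbit-∙-pow a i) (sym (trans (orbit-∙-pow b j) eqʲ)))

    sameVertex⇒sameCoset : ∀ {a b} → vertex a ≡ vertex b → SameCoset G K x y a b
    sameVertex⇒sameCoset eq = coset-half eq , coset-half (sym eq)

    sameCoset⇒sameVertex : ∀ {a b} → SameCoset G K x y a b → vertex a ≡ vertex b
    sameCoset⇒sameVertex {a} {b} (a⊆bY , _) with a⊆bY 0
    ... | j , eq = trans (sym (vertex-∙-pow a 0)) (trans (cong vertex eq) (vertex-∙-pow b j))

    sameVertex⇒∈coset : ∀ {a b} → vertex a ≡ vertex b → ∃[ j ] (b ≡ a ∙ pow y j)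
    sameVertex⇒∈coset {a} {b} eq with coset-half (sym eq) 0
    ... | j , eqʲ = j , trans (sym (identityʳ b)) eqʲ

    G=KY : ∀ g → ∃[ k ] ∃[ i ] (T (K k) × g ≡ k ∙ pow y i)
    G=KY g with sameVertex⇒∈coset {translation (vertex g)} {g} (vertex-translation (vertex g))
    ... | i , eq = translation (vertex g) , i , translation∈K (vertex g) , eq

    K∩Y=1 : ∀ g → T (K g) → InY G K x y g → g ≡ ε
    K∩Y=1 g g∈K (i , refl) = orbit-injective (trans (dart-≡ (vertex-pow i) (toWitness g∈K)) (sym orbit-ε))

    Y-fixes-origin-e : ∀ i d → origin d ≡ e → origin (ρ (pow y i) d) ≡ e
    Y-fixes-origin-e i d o≡e = trans (aut-respects-origin (ρ-aut (pow y i)) o≡e) (vertex-pow i)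

    conjugate-fixes-origin : ∀ h i d → origin d ≡ h →
                             origin (ρ ((translation h ∙ pow y i) ∙ translation h ⁻¹) d) ≡ h
    conjugate-fixes-origin h i d o≡h = begin
      origin (ρ ((t ∙ pow y i) ∙ t ⁻¹) d)        ≡⟨ cong origin (ρ-hom _ _ d) ⟩
      origin (ρ (t ∙ pow y i) (ρ (t ⁻¹) d))      ≡⟨ cong origin (ρ-hom _ _ _) ⟩
      origin (ρ t (ρ (pow y i) (ρ (t ⁻¹) d)))    ≡⟨ cong origin (ρ-translation h _) ⟩
      h * origin (ρ (pow y i) (ρ (t ⁻¹) d))      ≡⟨ cong (h *_) (Y-fixes-origin-e i _ (origin-ρ-translation⁻¹ h d o≡h)) ⟩
      h * e                                      ≡⟨ *-identityʳ h ⟩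
      h                                          ∎
      where t = translation h

    Y-corefree : ∀ g → (∀ c → ∃[ i ] (g ≡ (c ∙ pow y i) ∙ c ⁻¹)) → g ≡ ε
    Y-corefree g g∈conjugates = vertex-faithful λ d → fixes d (g∈conjugates (translation (origin d)))
      where
      fixes : ∀ d → ∃[ i ] (g ≡ (translation (origin d) ∙ pow y i) ∙ translation (origin d) ⁻¹) →
              origin (ρ g d) ≡ origin d
      fixes d (i , refl) = conjugate-fixes-origin (origin d) i d refl

    x-selfInverse : x ≡ x ⁻¹
    x-selfInverse = inverseʳ-unique x x (orbit-injective (begin
      orbit (x ∙ x)                 ≡⟨ orbit-∙ x x ⟩
      ρ x (orbit x)                 ≡⟨ cong (ρ x) orbit-x ⟩
      ρ x (rev H cm d₀)             ≡⟨ IsMapAut.f-rev (ρ-aut x) d₀ ⟩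
      rev H cm (orbit x)            ≡⟨ cong (rev H cm) orbit-x ⟩
      rev H cm (rev H cm d₀)        ≡⟨ rev-involutive d₀ ⟩
      d₀                            ≡⟨ orbit-ε ⟨
      orbit ε                       ∎))

    G=⟨Y,x⟩ : Generates G (λ g → (g ≡ y) ⊎ (g ≡ x))
    G=⟨Y,x⟩ g with dart-induction Reached reached-rot reached-rev (ε , orbit-ε , gen-ε) (orbit g)
      where
      Reached : Darts → Set
      Reached d = ∃[ g ] (orbit g ≡ d × Gen G (λ g → (g ≡ y) ⊎ (g ≡ x)) g)
      reached-rot : ∀ {d} → Reached d → Reached (rot H cm d)
      reached-rot (g , refl , g∈⟨Y,x⟩) = g ∙ y , trans (orbit-∙ g y)
        (trans (cong (ρ g) orbit-y) (IsMapAut.f-rot (ρ-aut g) d₀)) , gen-mul g∈⟨Y,x⟩ (gen-in (inj₁ refl))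
      reached-rev : ∀ {d} → Reached d → Reached (rev H cm d)
      reached-rev (g , refl , g∈⟨Y,x⟩) = g ∙ x , trans (orbit-∙ g x)
        (trans (cong (ρ g) orbit-x) (IsMapAut.f-rev (ρ-aut g) d₀)) , gen-mul g∈⟨Y,x⟩ (gen-in (inj₂ refl))
    ... | g′ , orbit-g′≡orbit-g , g′∈⟨Y,x⟩ = subst (Gen G _) (orbit-injective orbit-g′≡orbit-g) g′∈⟨Y,x⟩

    vertex-pow-∙-x : ∀ a → vertex (pow y a ∙ x) ≡ iter p a x₀
    vertex-pow-∙-x a = begin
      origin (orbit (pow y a ∙ x))                   ≡⟨ cong origin (orbit-∙ (pow y a) x) ⟩
      origin (ρ (pow y a) (orbit x))                 ≡⟨ cong (λ d → origin (ρ (pow y a) d)) orbit-x ⟩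
      origin (ρ (pow y a) (rev H cm d₀))             ≡⟨ cong origin (IsMapAut.f-rev (ρ-aut (pow y a)) d₀) ⟩
      origin (rev H cm (orbit (pow y a)))            ≡⟨ cong (λ d → origin (rev H cm d)) (orbit-pow a) ⟩
      origin (rot^ a d₀) * label (rot^ a d₀)         ≡⟨ cong₂ _*_ (origin-rot^ a d₀) (label-rot^ a d₀) ⟩
      e * iter p a x₀                                ≡⟨ *-identityˡ _ ⟩
      iter p a x₀                                    ∎

    vertex∈X⇒∈YxY : ∀ g → T (X (vertex g)) → ∃[ a ] ∃[ b ] (g ≡ (pow y a ∙ x) ∙ pow y b)
    vertex∈X⇒∈YxY g vertex∈X with p-cyc x₀∈X vertex∈X
    ... | a , eq with sameVertex⇒∈coset {pow y a ∙ x} {g} (trans (vertex-pow-∙-x a) eq)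
    ...   | b , g≡ = a , b , g≡

    y≢ε : ∀ {b} → T (X b) → ¬ x₀ ≡ b → ¬ y ≡ ε
    y≢ε b∈X x₀≢b y≡ε with p-cyc x₀∈X b∈X
    ... | i , pⁱx₀≡b = x₀≢b (trans (sym (iter-fixed p px₀≡x₀ i)) pⁱx₀≡b)
      where
      px₀≡x₀ : p x₀ ≡ x₀
      px₀≡x₀ = cong label (trans (sym orbit-y) (trans (cong orbit y≡ε) orbit-ε))

    admissible : ∀ {b} → T (X b) → ¬ x₀ ≡ b → Admissible G K x y
    admissible b∈X x₀≢b = record
      { K-sub      = K-subgroup
      ; K-nontriv  = translation x₀ , translation∈K x₀ , translation-nontrivial
      ; y≢1        = y≢ε b∈X x₀≢b
      ; G=KY       = G=KY
      ; K∩Y=1      = K∩Y=1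
      ; Y-corefree = Y-corefree
      ; G=⟨Y,x⟩    = G=⟨Y,x⟩
      ; YxY⊆Yx⁻¹Y = λ i j → i , j , cong (λ t → (pow y i ∙ t) ∙ pow y j) x-selfInverse
      ; Yx⁻¹Y⊆YxY = λ i j → i , j , cong (λ t → (pow y i ∙ t) ∙ pow y j) (sym x-selfInverse)
      }

    translation∈X′ : ∀ h → T (X h) → InducedX G K x y (translation h)
    translation∈X′ h h∈X = translation∈K h , λ i → vertex∈X⇒∈YxY _
      (subst (λ z → T (X z)) (sym (trans (vertex-∙-pow (translation h) i) (vertex-translation h))) h∈X)

    translation∈X′⇒∈X : ∀ h → InducedX G K x y (translation h) → T (X h)
    translation∈X′⇒∈X h (_ , tY⊆YxY) with tY⊆YxY 0
    ... | a , b , eq = subst (λ z → T (X z)) (begin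
      iter p a x₀                            ≡⟨ vertex-pow-∙-x a ⟨
      vertex (pow y a ∙ x)                   ≡⟨ vertex-∙-pow _ b ⟨
      vertex ((pow y a ∙ x) ∙ pow y b)       ≡⟨ cong vertex eq ⟨
      vertex (translation h ∙ pow y 0)       ≡⟨ vertex-∙-pow _ 0 ⟩
      vertex (translation h)                 ≡⟨ vertex-translation h ⟩
      h                                      ∎) (X-iter-p a x₀∈X)

    translation-rot : ∀ h → InducedRot G K x y (translation h) (translation (p h))
    translation-rot h x₀′ j (_ , x₀′Y=xY) (_ , tY=yʲx₀′Y) =
      translation∈K (p h) , sameVertex⇒sameCoset (begin
        vertex (translation (p h))           ≡⟨ vertex-translation (p h) ⟩
        p h                                  ≡⟨ cong p h≡pʲx₀ ⟩
        iter p (suc j) x₀                    ≡⟨ vertex-pow-∙-x₀′ (suc j) ⟨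
        vertex (pow y (suc j) ∙ x₀′)         ∎)
      where
      vertex-pow-∙-x₀′ : ∀ i → vertex (pow y i ∙ x₀′) ≡ iter p i x₀
      vertex-pow-∙-x₀′ i = trans (vertex-∙-congˡ (pow y i) (sameCoset⇒sameVertex x₀′Y=xY)) (vertex-pow-∙-x i)
      h≡pʲx₀ : h ≡ iter p j x₀
      h≡pʲx₀ = trans (sym (vertex-translation h))
        (trans (sameCoset⇒sameVertex tY=yʲx₀′Y) (vertex-pow-∙-x₀′ j))

    inducedEquiv : InducedEquiv H G X p K x y
    inducedEquiv = record
      { φ      = translation
      ; φ-hom  = translation-hom
      ; φ-inj  = translation-injective
      ; φ-onto = λ g g∈K → vertex g , K⊆translations g∈K
      ; φ-in-K = translation∈K
      ; φ-X→X' = translation∈X′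
      ; φ-X'→X = translation∈X′⇒∈X
      ; φ-rot  = λ h _ → translation-rot h
      }

lemma3p3 : (H : FinGroup) (X : FinGroup.Carrier H → Bool)
           (p : FinGroup.Carrier H → FinGroup.Carrier H)
           (cm : IsCayleyMapData H X p) →
           (∃[ a ] ∃[ b ] (T (X a) × T (X b) × ¬ (a ≡ b))) →
           IsRegular H cm →
           (G : FinGroup) → AutIso H cm G →
           ∃[ K ] ∃[ x ] ∃[ y ] (Admissible G K x y × InducedEquiv H G X p K x y)
lemma3p3 H X p cm (a , b , a∈X , b∈X , a≢b) regular G iso =
  K , proj₁ reversal , proj₁ rotation , admissible b∈X a≢b , inducedEquiv
  where
  open AutGroupAction H cm G iso a∈X
  rotation : ∃[ g ] (orbit g ≡ rot H cm d₀)
  rotation = orbit-surjective regular (rot H cm d₀)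
  reversal : ∃[ g ] (orbit g ≡ rev H cm d₀)
  reversal = orbit-surjective regular (rev H cm d₀)
  open InducedQuadruple (proj₁ rotation) (proj₁ reversal) (proj₂ rotation) (proj₂ reversal)
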